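{- Let $S[1:n]$ be a sequence of distinct real numbers, $k\ge 3$, and let $S_1,\dots,S_m$ be an alternating $k$-decomposition of $S$. Let $A$ be a subsequence of $S$ that is a $k$-rollercoaster. Then every part $S_\ell$ contains elements of at most four consecutive runs of $A$.
   Context: A subsequence of $S$ is $(S[i_1],\dots,S[i_m])$ with $i_1<\dots<i_m$. A run of a sequence is a maximal contiguous subsequence that is increasing or decreasing; a $k$-rollercoaster is a sequence every run of which has length at least $k$. LIS (respectively LDS) denotes a longest increasing (respectively decreasing), not necessarily contiguous, subsequence. An alternating $k$-decomposition of $S[1:n]$ is a partition of $S$ into consecutive contiguous subsequences (parts) $S_1,\ldots,S_m$ where, for $\ell\ge1$, $S_\ell$ is the shortest contiguous subsequence of $S$ starting directly after $S_1\cdots S_{\ell-1}$ whose LIS has length $k$ if $\ell$ is odd (whose LDS has length $k$ if $\ell$ is even), if such exists; otherwise $S_\ell$ is the whole remaining suffix of $S$. -}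

module Defs where

open import Level using (Level)
open import Data.Bool using (Bool; true; false; not)
open import Data.Nat using (ℕ; _≤_; _<_)
open import Data.List using (List; []; _∷_; _++_; length)
open import Data.List.Relation.Binary.Sublist.Propositional using (_⊆_)
open import Data.List.Relation.Unary.Linked using (Linked)
open import Data.List.Membership.Propositional using (_∈_)
open import Data.Product using (Σ; ∃; _×_; _,_)
open import Data.Sum using (_⊎_)
open import Relation.Binary.PropositionalEquality using (_≡_; _≢_)
open import Relation.Nullary using (¬_)
open import Function using (flip)

-- Everything is parametric in a strict order _<ₛ_ on a carrier C
-- (the real numbers with their usual order are one instance).
module _ {C : Set} (_<ₛ_ : C → C → Set) where

  Increasing : List C → Set
  Increasing = Linked _<ₛ_

  Decreasing : List C → Set
  Decreasing = Linked (flip _<ₛ_)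

  Monotone : List C → Set
  Monotone xs = Increasing xs ⊎ Decreasing xs

  LISLength : List C → ℕ → Set
  LISLength xs k =
    (Σ (List C) λ ys → ys ⊆ xs × Increasing ys × length ys ≡ k)
    × (∀ ys → ys ⊆ xs → Increasing ys → length ys ≤ k)

  LDSLength : List C → ℕ → Set
  LDSLength xs k =
    (Σ (List C) λ ys → ys ⊆ xs × Decreasing ys × length ys ≡ k)
    × (∀ ys → ys ⊆ xs → Decreasing ys → length ys ≤ k)

  -- odd-indexed parts use LIS (flag true), even-indexed parts use LDS (flag false)
  Target : Bool → List C → ℕ → Set
  Target true  = LISLength
  Target false = LDSLength

  data AltDec (k : ℕ) : Bool → List C → List (List C) → Set where
    done  : ∀ {b} → AltDec k b [] []
    cut   : ∀ {b} (P rest : List C) {parts} →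
            Target b P k →
            (∀ Q Q' → Q ++ Q' ≡ P ++ rest → length Q < length P → ¬ Target b Q k) →
            AltDec k (not b) rest parts →
            AltDec k b (P ++ rest) (P ∷ parts)
    final : ∀ {b} (xs : List C) →
            xs ≢ [] →
            (∀ Q Q' → Q ++ Q' ≡ xs → ¬ Target b Q k) →
            AltDec k b xs (xs ∷ [])

  AlternatingDecomposition : ℕ → List C → List (List C) → Set
  AlternatingDecomposition k S parts = AltDec k true S parts

  record Run (A : List C) : Set where
    field
      pre seg post : List C
      split : A ≡ pre ++ seg ++ post
      mono  : Monotone seg
      maximal : ∀ p a b q → p ++ a ≡ pre → b ++ q ≡ post →
                a ++ b ≢ [] → ¬ Monotone (a ++ seg ++ b)

  Rollercoaster : ℕ → List C → Set
  Rollercoaster k A = (r : Run A) → k ≤ length (Run.seg r)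

  Meets : {A : List C} → Run A → List C → Set
  Meets r P = ∃ λ x → x ∈ Run.seg r × x ∈ P

  -- P contains elements of at most four runs of A: there are no five distinct
  -- runs (distinct, ordered by starting position) each meeting P.
  AtMostFourRuns : List C → List C → Set
  AtMostFourRuns A P =
    ¬ (Σ (Run A) λ r₁ → Σ (Run A) λ r₂ → Σ (Run A) λ r₃ → Σ (Run A) λ r₄ → Σ (Run A) λ r₅ →
         length (Run.pre r₁) < length (Run.pre r₂) ×
         length (Run.pre r₂) < length (Run.pre r₃) ×
         length (Run.pre r₃) < length (Run.pre r₄) ×
         length (Run.pre r₄) < length (Run.pre r₅) ×
         Meets r₁ P × Meets r₂ P × Meets r₃ P × Meets r₄ P × Meets r₅ P)

-- A part P of the decomposition has a direction (increasing or decreasing) in which every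
-- proper prefix of P has only chains shorter than k.  Suppose five runs of A meet P, with x in
-- the first and y in the last.  Consecutive runs of A share an endpoint and alternate in
-- direction, so the second run, the third run, or the run starting where the second one ends
-- goes in the direction of P and lies between x and y.  Since A is a subsequence of S and P is
-- contiguous in S, that run lies in the proper prefix of P ending before y; but it is a chain of
-- length at least k, a contradiction.

module Submission where

open import Data.Bool using (Bool; true; false; not)
open import Data.Bool.Properties using (not-¬; ¬-not) renaming (_≟_ to _≟ᵇ_)
open import Data.Nat using (ℕ; zero; suc; _+_; _≤_; _<_; z≤n; s≤s)
open import Data.Nat.Properties
open import Data.List using (List; []; _∷_; _++_; length; take; drop; initLast; _∷ʳ′_)
open import Data.List.Properties using (take++drop≡id; drop-drop; ++-identityʳ; ∷ʳ-++; ++-assoc; length-++)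
open import Data.List.Relation.Binary.Sublist.Propositional using (_⊆_; []; _∷_; _∷ʳ_; ⊆-refl; ⊆-trans)
open import Data.List.Relation.Binary.Sublist.Propositional.Properties using (++⁺ˡ; Any-resp-⊆; All-resp-⊆; []⊆-universal)
open import Data.List.Relation.Unary.All as All using ([]; _∷_)
open import Data.List.Relation.Unary.Any using (here; there)
open import Data.List.Relation.Unary.AllPairs using ([]; _∷_)
open import Data.List.Relation.Unary.Linked using (Linked; []; [-]; _∷_)
open import Data.List.Relation.Unary.Unique.Propositional using (Unique)
open import Data.List.Relation.Unary.Unique.Propositional.Properties using (drop⁺)
open import Data.List.Membership.Propositional using (_∈_)
open import Data.List.Membership.Propositional.Properties using (∈-++⁺ˡ; ∈-++⁺ʳ; ∈-insert)
open import Data.Product using (Σ; ∃; ∃₂; _×_; _,_)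
open import Data.Sum using (_⊎_; inj₁; inj₂)
open import Data.Empty using (⊥-elim)
open import Function using (flip)
open import Relation.Binary.PropositionalEquality
open import Relation.Binary.Structures using (IsStrictTotalOrder)
open import Relation.Binary.Definitions using (tri<; tri≈; tri>)
open import Relation.Nullary using (¬_; Dec; yes; no; contradiction)
open import Defs

-- Positions and sublists

module _ {C : Set} where

  drop-suc : ∀ i (xs : List C) {x ys} → drop i xs ≡ x ∷ ys → drop (suc i) xs ≡ ys
  drop-suc zero    (x ∷ xs) refl = refl
  drop-suc (suc i) (x ∷ xs) eq   = drop-suc i xs eq

  drop≡∷⇒< : ∀ i (xs : List C) {x ys} → drop i xs ≡ x ∷ ys → i < length xs
  drop≡∷⇒< zero    (x ∷ xs) _  = s≤s z≤n
  drop≡∷⇒< (suc i) (x ∷ xs) eq = s≤s (drop≡∷⇒< i xs eq)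

  <length⇒drop≡∷∷ : ∀ i (xs : List C) → suc i < length xs → ∃₂ λ x y → ∃ λ zs → drop i xs ≡ x ∷ y ∷ zs
  <length⇒drop≡∷∷ zero    (x ∷ y ∷ zs) _        = x , y , zs , refl
  <length⇒drop≡∷∷ zero    (x ∷ [])     (s≤s ())
  <length⇒drop≡∷∷ (suc i) (x ∷ xs)     (s≤s p)  = <length⇒drop≡∷∷ i xs p

  drop-length-++ : ∀ (u : List C) {v} → drop (length u) (u ++ v) ≡ v
  drop-length-++ []      = refl
  drop-length-++ (x ∷ u) = drop-length-++ u

  drop-prefix : ∀ {xs} (u : List C) {v} → xs ≡ u ++ v → drop (length u) xs ≡ v
  drop-prefix u refl = drop-length-++ u

  ∈⇒drop-++ : ∀ {x} {u : List C} v → x ∈ u → ∃₂ λ j ys → j < length u × drop j (u ++ v) ≡ x ∷ ys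
  ∈⇒drop-++ v (here refl) = 0 , _ , s≤s z≤n , refl
  ∈⇒drop-++ v (there x∈u) with ∈⇒drop-++ v x∈u
  ... | j , ys , j< , eq = suc j , ys , s≤s j< , eq

  split-at : ∀ s n (xs : List C) → s + n ≤ length xs →
             ∃₂ λ u W → ∃ λ v → xs ≡ u ++ W ++ v × length u ≡ s × length W ≡ n
  split-at zero    zero    xs       _       = [] , [] , xs , refl , refl , refl
  split-at zero    (suc n) (x ∷ xs) (s≤s p) with split-at zero n xs p
  ... | [] , W , v , refl , _ , refl = [] , x ∷ W , v , refl , refl , refl
  split-at (suc s) n       (x ∷ xs) (s≤s p) with split-at s n xs p
  ... | u , W , v , refl , refl , refl = x ∷ u , W , v , refl , refl , refl

  length-∷ʳ : ∀ (u : List C) {x} → length (u ++ x ∷ []) ≡ suc (length u)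
  length-∷ʳ []      = refl
  length-∷ʳ (_ ∷ u) = cong suc (length-∷ʳ u)

  ++-≢[]ʳ : ∀ (xs : List C) {ys} → ys ≢ [] → xs ++ ys ≢ []
  ++-≢[]ʳ []      ys≢[] = ys≢[]
  ++-≢[]ʳ (_ ∷ _) _     = λ ()

  proper-prefix-shorter : ∀ (Q : List C) {Q' P} → Q ++ Q' ≡ P → Q' ≢ [] → length Q < length P
  proper-prefix-shorter []      {[]}    _    Q'≢[] = contradiction refl Q'≢[]
  proper-prefix-shorter []      {_ ∷ _} refl _     = s≤s z≤n
  proper-prefix-shorter (_ ∷ Q) refl Q'≢[] = s≤s (proper-prefix-shorter Q refl Q'≢[])

  Unique-resp-⊇ : ∀ {xs ys : List C} → xs ⊆ ys → Unique ys → Unique xs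
  Unique-resp-⊇ []           u        = u
  Unique-resp-⊇ (y ∷ʳ xs⊆)   (_ ∷ u)  = Unique-resp-⊇ xs⊆ u
  Unique-resp-⊇ (refl ∷ xs⊆) (y∉ ∷ u) = All-resp-⊆ xs⊆ y∉ ∷ Unique-resp-⊇ xs⊆ u

  ⊆-∷ʳ⁻ : ∀ {ys : List C} Q {x} → ys ⊆ Q ++ x ∷ [] → ys ⊆ Q ⊎ ∃ λ ys' → ys ≡ ys' ++ x ∷ [] × ys' ⊆ Q
  ⊆-∷ʳ⁻ []      (_ ∷ʳ [])   = inj₁ []
  ⊆-∷ʳ⁻ []      (refl ∷ []) = inj₂ ([] , refl , [])
  ⊆-∷ʳ⁻ (q ∷ Q) (.q ∷ʳ s)  with ⊆-∷ʳ⁻ Q s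
  ... | inj₁ s'               = inj₁ (q ∷ʳ s')
  ... | inj₂ (ys' , eq , s')  = inj₂ (ys' , eq , q ∷ʳ s')
  ⊆-∷ʳ⁻ (q ∷ Q) (refl ∷ s)  with ⊆-∷ʳ⁻ Q s
  ... | inj₁ s'               = inj₁ (refl ∷ s')
  ... | inj₂ (ys' , eq , s')  = inj₂ (q ∷ ys' , cong (q ∷_) eq , refl ∷ s')

  ⊆-take-++ : ∀ (W : List C) {q} m → length W ≤ m → W ⊆ take m (W ++ q)
  ⊆-take-++ []      {q} m       _       = []⊆-universal (take m q)
  ⊆-take-++ (w ∷ W)     (suc m) (s≤s p) = refl ∷ ⊆-take-++ W m p

  window-⊆ : ∀ i j m (xs : List C) {W q} → drop j xs ≡ W ++ q → i ≤ j → j + length W ≤ i + m → W ⊆ take m (drop i xs)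
  window-⊆ zero    zero    m       xs       refl _       p = ⊆-take-++ _ m p
  window-⊆ zero    (suc j) (suc m) (x ∷ xs) eq     _       (s≤s p) = x ∷ʳ window-⊆ zero j m xs eq z≤n p
  window-⊆ (suc i) (suc j) m       (x ∷ xs) eq     (s≤s q) p = window-⊆ i j m xs eq q (≤-pred p)
  window-⊆ i       (suc j) m       []       {[]} _ _       _ = []⊆-universal _

  ∈-middle-⊆ : ∀ (M : List C) {y R T} → M ++ y ∷ R ⊆ T → y ∈ T
  ∈-middle-⊆ M s = Any-resp-⊆ s (∈-insert M)

  ⊆-suffix-from : ∀ (X L : List C) {x M T} → L ++ x ∷ M ⊆ X ++ T → x ∈ T → Unique (X ++ T) → x ∷ M ⊆ T
  ⊆-suffix-from []      L       s          _   _        = ⊆-trans (++⁺ˡ L ⊆-refl) s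
  ⊆-suffix-from (z ∷ X) []      (.z ∷ʳ s)  x∈T (_ ∷ u)  = ⊆-suffix-from X [] s x∈T u
  ⊆-suffix-from (z ∷ X) []      (refl ∷ _) x∈T (z∉ ∷ _) = ⊥-elim (All.lookup z∉ (∈-++⁺ʳ X x∈T) refl)
  ⊆-suffix-from (z ∷ X) (l ∷ L) (.z ∷ʳ s)  x∈T (_ ∷ u)  = ⊆-suffix-from X (l ∷ L) s x∈T u
  ⊆-suffix-from (z ∷ X) (l ∷ L) (refl ∷ s) x∈T (_ ∷ u)  = ⊆-suffix-from X L s x∈T u

  ⊆-proper-prefix-before : ∀ (P : List C) {M y R Y} → M ++ y ∷ R ⊆ P ++ Y → y ∈ P → Unique (P ++ Y) →
                           ∃₂ λ Q Q' → P ≡ Q ++ Q' × Q' ≢ [] × M ⊆ Q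
  ⊆-proper-prefix-before (p ∷ P) {[]}    (refl ∷ _) _           _          = [] , p ∷ P , refl , (λ ()) , []
  ⊆-proper-prefix-before (p ∷ P) {M}     (.p ∷ʳ s)  (here refl) (p∉ ∷ _)   = ⊥-elim (All.lookup p∉ (∈-middle-⊆ M s) refl)
  ⊆-proper-prefix-before (p ∷ P) {_ ∷ M} (refl ∷ s) (here refl) (p∉ ∷ _)   = ⊥-elim (All.lookup p∉ (∈-middle-⊆ M s) refl)
  ⊆-proper-prefix-before (p ∷ P)         (.p ∷ʳ s)  (there y∈P) (_ ∷ u)    with ⊆-proper-prefix-before P s y∈P u
  ... | Q , Q' , eq , Q'≢[] , M⊆Q = p ∷ Q , Q' , cong (p ∷_) eq , Q'≢[] , p ∷ʳ M⊆Q
  ⊆-proper-prefix-before (p ∷ P) {_ ∷ M} (refl ∷ s) (there y∈P) (_ ∷ u)    with ⊆-proper-prefix-before P s y∈P u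
  ... | Q , Q' , eq , Q'≢[] , M⊆Q = p ∷ Q , Q' , cong (p ∷_) eq , Q'≢[] , refl ∷ M⊆Q

  ⊆-proper-prefix-between : ∀ (X P : List C) {Y L x M y R} → L ++ x ∷ M ++ y ∷ R ⊆ X ++ P ++ Y → Unique (X ++ P ++ Y) →
                            x ∈ P → y ∈ P → ∃₂ λ Q Q' → P ≡ Q ++ Q' × Q' ≢ [] × x ∷ M ⊆ Q
  ⊆-proper-prefix-between X P {L = L} s u x∈P y∈P =
    ⊆-proper-prefix-before P (⊆-suffix-from X L s (∈-++⁺ˡ x∈P) u) y∈P (Unique-resp-⊇ (++⁺ˡ X ⊆-refl) u)

  interval-⊆-proper-prefix : ∀ (X P : List C) {Y A} i t {x y xs ys} → A ⊆ X ++ P ++ Y → Unique (X ++ P ++ Y) →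
                             drop i A ≡ x ∷ xs → drop (i + suc t) A ≡ y ∷ ys → x ∈ P → y ∈ P →
                             ∃₂ λ Q Q' → P ≡ Q ++ Q' × Q' ≢ [] × take (suc t) (drop i A) ⊆ Q
  interval-⊆-proper-prefix X P {A = A} i t {x} {y} {xs} {ys} A⊆ u at-i at-j x∈P y∈P
    rewrite at-i = ⊆-proper-prefix-between X P (subst (_⊆ X ++ P ++ _) A≡ A⊆) u x∈P y∈P
    where
    open ≡-Reasoning
    drop-t : drop t xs ≡ y ∷ ys
    drop-t = begin
      drop t xs                ≡⟨ cong (drop t) (sym (drop-suc i A at-i)) ⟩
      drop t (drop (suc i) A)  ≡⟨ drop-drop (suc i) t A ⟩
      drop (suc i + t) A       ≡⟨ cong (λ n → drop n A) (sym (+-suc i t)) ⟩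
      drop (i + suc t) A       ≡⟨ at-j ⟩
      y ∷ ys                   ∎
    A≡ : A ≡ take i A ++ x ∷ take t xs ++ y ∷ ys
    A≡ = begin
      A                                      ≡⟨ sym (take++drop≡id i A) ⟩
      take i A ++ drop i A                   ≡⟨ cong (take i A ++_) at-i ⟩
      take i A ++ x ∷ xs                     ≡⟨ cong (λ zs → take i A ++ x ∷ zs) (sym (take++drop≡id t xs)) ⟩
      take i A ++ x ∷ take t xs ++ drop t xs ≡⟨ cong (λ zs → take i A ++ x ∷ take t xs ++ zs) drop-t ⟩
      take i A ++ x ∷ take t xs ++ y ∷ ys    ∎

-- Chains in prefixes

module _ {C : Set} {R : C → C → Set} where

  Linked-snoc : ∀ (W : List C) {z b} → Linked R (W ++ z ∷ []) → R z b → Linked R (W ++ z ∷ b ∷ [])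
  Linked-snoc []           _          r = r ∷ [-]
  Linked-snoc (w ∷ [])     (r' ∷ _)   r = r' ∷ r ∷ [-]
  Linked-snoc (w ∷ w' ∷ W) (r' ∷ lin) r = r' ∷ Linked-snoc (w' ∷ W) lin r

  Linked-++⁻ˡ : ∀ (ys : List C) {zs} → Linked R (ys ++ zs) → Linked R ys
  Linked-++⁻ˡ []            _         = []
  Linked-++⁻ˡ (y ∷ [])      _         = [-]
  Linked-++⁻ˡ (y ∷ y' ∷ ys) (r ∷ lin) = r ∷ Linked-++⁻ˡ (y' ∷ ys) lin

  ChainsBelow : ℕ → List C → Set
  ChainsBelow k Q = ∀ ys → ys ⊆ Q → Linked R ys → length ys < k

  ChainsBelow-[] : ∀ {k} → 0 < k → ChainsBelow k []
  ChainsBelow-[] 0<k .[] [] _ = 0<k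

  ChainsBelow-∷ʳ-≤ : ∀ {k Q x} → ChainsBelow k Q → ∀ ys → ys ⊆ Q ++ x ∷ [] → Linked R ys → length ys ≤ k
  ChainsBelow-∷ʳ-≤ {k} {Q} below ys ys⊆ lin with ⊆-∷ʳ⁻ Q ys⊆
  ... | inj₁ ys⊆Q             = <⇒≤ (below ys ys⊆Q lin)
  ... | inj₂ (ys' , refl , s) = subst (_≤ k) (sym (length-∷ʳ ys')) (below ys' s (Linked-++⁻ˡ ys' lin))

  -- Appending one element lengthens a chain by at most one, so a prefix whose chains first
  -- reach length k has LIS exactly k.
  ChainsBelow-∷ʳ : ∀ {k Q x} → ChainsBelow k Q → ¬ LISLength R (Q ++ x ∷ []) k → ChainsBelow k (Q ++ x ∷ [])
  ChainsBelow-∷ʳ below ¬lis ys ys⊆ lin with m≤n⇒m<n∨m≡n (ChainsBelow-∷ʳ-≤ below ys ys⊆ lin)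
  ... | inj₁ ∣ys∣<k = ∣ys∣<k
  ... | inj₂ ∣ys∣≡k = contradiction ((ys , ys⊆ , lin , ∣ys∣≡k) , ChainsBelow-∷ʳ-≤ below) ¬lis

  ChainsBelow-prefixes : ∀ {k} Q → 0 < k → (∀ Q₁ Q₂ → Q₁ ++ Q₂ ≡ Q → ¬ LISLength R Q₁ k) → ChainsBelow k Q
  ChainsBelow-prefixes {k} Q 0<k no-lis = go [] Q (ChainsBelow-[] 0<k) no-lis
    where
    go : ∀ P Q → ChainsBelow k P → (∀ Q₁ Q₂ → Q₁ ++ Q₂ ≡ Q → ¬ LISLength R (P ++ Q₁) k) → ChainsBelow k (P ++ Q)
    go P []      below _      = subst (ChainsBelow k) (sym (++-identityʳ P)) below
    go P (x ∷ Q) below no-lis = subst (ChainsBelow k) (++-assoc P (x ∷ []) Q)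
      (go (P ++ x ∷ []) Q (ChainsBelow-∷ʳ below (no-lis (x ∷ []) Q refl))
        λ Q₁ Q₂ eq → subst (λ xs → ¬ LISLength R xs k) (sym (++-assoc P (x ∷ []) Q₁)) (no-lis (x ∷ Q₁) Q₂ (cong (x ∷_) eq)))

-- Directions and parts of the decomposition

module _ {C : Set} (_<ₛ_ : C → C → Set) where

  Ordered : Bool → C → C → Set
  Ordered true  = _<ₛ_
  Ordered false = flip _<ₛ_

  Linked⇒Monotone : ∀ d {xs} → Linked (Ordered d) xs → Monotone _<ₛ_ xs
  Linked⇒Monotone true  = inj₁
  Linked⇒Monotone false = inj₂

  Monotone⇒Linked : ∀ {xs} → Monotone _<ₛ_ xs → ∃ λ d → Linked (Ordered d) xs
  Monotone⇒Linked (inj₁ inc) = true , inc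
  Monotone⇒Linked (inj₂ dec) = false , dec

  data LeadingStep (d : Bool) : List C → Set where
    step : ∀ {x y zs} → Ordered d x y → LeadingStep d (x ∷ y ∷ zs)

module _ {C : Set} {_<ₛ_ : C → C → Set} where

  LISLength⇒Target : ∀ d {Q k} → LISLength (Ordered _<ₛ_ d) Q k → Target _<ₛ_ d Q k
  LISLength⇒Target true  lis = lis
  LISLength⇒Target false lis = lis

  PrefixMinimal : ℕ → Bool → List C → Set
  PrefixMinimal k d P = ∀ Q Q' → Q ++ Q' ≡ P → Q' ≢ [] → ¬ Target _<ₛ_ d Q k

  part-minimal : ∀ {k b S parts P} → AltDec _<ₛ_ k b S parts → P ∈ parts →
                 ∃ λ d → ∃₂ λ X Y → S ≡ X ++ P ++ Y × PrefixMinimal k d P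
  part-minimal {b = b} (cut P rest _ minimal _) (here refl) =
    b , [] , rest , refl , λ Q Q' eq Q'≢[] →
      minimal Q (Q' ++ rest) (trans (sym (++-assoc Q Q' rest)) (cong (_++ rest) eq)) (proper-prefix-shorter Q {Q'} eq Q'≢[])
  part-minimal (cut P₀ rest _ _ dec) (there P∈) with part-minimal dec P∈
  ... | d , X , Y , refl , minimal = d , P₀ ++ X , Y , sym (++-assoc P₀ X _) , minimal
  part-minimal {b = b} (final xs _ minimal) (here refl) = b , [] , [] , sym (++-identityʳ xs) , λ Q Q' eq _ → minimal Q Q' eq

  proper-prefix-ChainsBelow : ∀ {k d P Q Q'} → 0 < k → PrefixMinimal k d P → P ≡ Q ++ Q' → Q' ≢ [] →
                              ChainsBelow {R = Ordered _<ₛ_ d} k Q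
  proper-prefix-ChainsBelow {d = d} {Q' = Q'} 0<k minimal refl Q'≢[] = ChainsBelow-prefixes {R = Ordered _<ₛ_ d} _ 0<k λ Q₁ Q₂ eq lis →
    minimal Q₁ (Q₂ ++ Q') (trans (sym (++-assoc Q₁ Q₂ Q')) (cong (_++ Q') eq)) (++-≢[]ʳ Q₂ Q'≢[]) (LISLength⇒Target d lis)

module _ {C : Set} {_<ₛ_ : C → C → Set} (sto : IsStrictTotalOrder _≡_ _<ₛ_) where
  open IsStrictTotalOrder sto using (compare; asym) renaming (_<?_ to _<ₛ?_)

  Ordered-dec : ∀ d x y → Dec (Ordered _<ₛ_ d x y)
  Ordered-dec true  x y = x <ₛ? y
  Ordered-dec false x y = y <ₛ? x

  Ordered-total : ∀ d {x y} → x ≢ y → ¬ Ordered _<ₛ_ d x y → Ordered _<ₛ_ (not d) x y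
  Ordered-total d {x} {y} x≢y ¬x<y with compare x y | d
  ... | tri< x<y _ _ | true  = contradiction x<y ¬x<y
  ... | tri< x<y _ _ | false = x<y
  ... | tri≈ _ x≡y _ | _     = contradiction x≡y x≢y
  ... | tri> _ _ y<x | true  = y<x
  ... | tri> _ _ y<x | false = contradiction y<x ¬x<y

  LeadingStep-direction : ∀ {d d' xs} → LeadingStep _<ₛ_ d xs → LeadingStep _<ₛ_ d' xs → d ≡ d'
  LeadingStep-direction {true}  {true}  _        _         = refl
  LeadingStep-direction {false} {false} _        _         = refl
  LeadingStep-direction {true}  {false} (step o) (step o') = ⊥-elim (asym o o')
  LeadingStep-direction {false} {true}  (step o) (step o') = ⊥-elim (asym o o')

  LeadingStep-dec : ∀ d xs → Dec (LeadingStep _<ₛ_ d xs)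
  LeadingStep-dec d []           = no λ ()
  LeadingStep-dec d (x ∷ [])     = no λ ()
  LeadingStep-dec d (x ∷ y ∷ zs) with Ordered-dec d x y
  ... | yes o = yes (step o)
  ... | no ¬o = no λ { (step o) → ¬o o }

  LeadingStep-total : ∀ d {x y zs} → Unique (x ∷ y ∷ zs) → ¬ LeadingStep _<ₛ_ d (x ∷ y ∷ zs) →
                      LeadingStep _<ₛ_ (not d) (x ∷ y ∷ zs)
  LeadingStep-total d ((x≢y ∷ _) ∷ _) ¬st = step (Ordered-total d x≢y (λ o → ¬st (step o)))

-- Runs of A by position

module Positions {C : Set} {_<ₛ_ : C → C → Set} (sto : IsStrictTotalOrder _≡_ _<ₛ_) (A : List C) (uA : Unique A) where

  -- A record rather than a synonym for LeadingStep d (drop i A), so that i can be inferred.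
  record Step (d : Bool) (i : ℕ) : Set where
    constructor at
    field leading : LeadingStep _<ₛ_ d (drop i A)

  Step⇒< : ∀ {d} i → Step d i → suc i < length A
  Step⇒< i (at st) with drop i A in eq | st
  ... | x ∷ y ∷ zs | step _ = drop≡∷⇒< (suc i) A (drop-suc i A eq)

  Step-next : ∀ {d i z zs} → Step d i → drop i A ≡ z ∷ zs → ∃₂ λ b q → zs ≡ b ∷ q × Ordered _<ₛ_ d z b
  Step-next (at st) eq with subst (LeadingStep _<ₛ_ _) eq st
  ... | step o = _ , _ , refl , o

  Step-ordered : ∀ {d i x y zs} → Step d i → drop i A ≡ x ∷ y ∷ zs → Ordered _<ₛ_ d x y
  Step-ordered st eq with Step-next st eq
  ... | _ , _ , refl , o = o

  Step-cons-Linked : ∀ {d i a W q} → Step d i → drop i A ≡ a ∷ W ++ q → Linked (Ordered _<ₛ_ d) W → Linked (Ordered _<ₛ_ d) (a ∷ W)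
  Step-cons-Linked {W = []}    _  _  _   = [-]
  Step-cons-Linked {W = _ ∷ _} st eq lin = Step-ordered st eq ∷ lin

  Step-total : ∀ d {i} → suc i < length A → ¬ Step d i → Step (not d) i
  Step-total d {i} i+1<∣A∣ ¬st with <length⇒drop≡∷∷ i A i+1<∣A∣
  ... | x , y , zs , eq = at (subst (LeadingStep _<ₛ_ (not d)) (sym eq)
    (LeadingStep-total sto d (subst Unique eq (drop⁺ i uA)) (λ st → ¬st (at (subst (LeadingStep _<ₛ_ d) (sym eq) st)))))

  Step-direction : ∀ {d d' i} → Step d i → Step d' i → d ≡ d'
  Step-direction (at st) (at st') = LeadingStep-direction sto st st'

  Step-opposite : ∀ {d i} → Step d i → ¬ Step (not d) i
  Step-opposite st st' = not-¬ refl (Step-direction st st')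

  -- Steps d lo hi: the elements at positions lo, …, hi - 1 of A form a d-monotone segment.
  Steps : Bool → ℕ → ℕ → Set
  Steps d lo hi = ∀ {i} → lo ≤ i → suc i < hi → Step d i

  Steps-empty : ∀ {d s} → Steps d s (suc s)
  Steps-empty s≤i (s≤s i<s) = contradiction i<s (≤⇒≯ s≤i)

  Steps-extend : ∀ {d s e} → Steps d s (suc e) → Step d e → Steps d s (suc (suc e))
  Steps-extend steps st s≤i (s≤s i<e+1) with m≤n⇒m<n∨m≡n (≤-pred i<e+1)
  ... | inj₁ i<e  = steps s≤i (s≤s i<e)
  ... | inj₂ refl = st

  -- The positions s, …, e of A (both ends included) form a run in direction d.
  record RunAt (d : Bool) (s e : ℕ) : Set where
    field
      s<e         : s < e
      steps       : Steps d s (suc e)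
      stops-left  : ∀ {i} → suc i ≡ s → ¬ Step d i
      stops-right : ¬ Step d e

  runs-ordered : ∀ {d d' s e s' e'} → RunAt d s e → RunAt d' s' e' → s < s' → e ≤ s'
  runs-ordered {e = e} {s' = suc i} r r' (s≤s s≤i) with e ≤? suc i
  ... | yes e≤s' = e≤s'
  ... | no  e≰s' = ⊥-elim (RunAt.stops-left r' refl (subst (λ d → Step d i) d≡d' (RunAt.steps r s≤i (s≤s (<⇒≤ s'<e)))))
    where
    s'<e = ≰⇒> e≰s'
    d≡d' = Step-direction (RunAt.steps r (m≤n⇒m≤1+n s≤i) (s≤s s'<e)) (RunAt.steps r' ≤-refl (s≤s (RunAt.s<e r')))

  runs-alternate : ∀ {d s e e'} → RunAt d s e → ¬ RunAt d e e'
  runs-alternate r r' = RunAt.stops-right r (RunAt.steps r' ≤-refl (s≤s (RunAt.s<e r')))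

  runAt-from : ∀ {d s} → Step d s → (∀ {i} → suc i ≡ s → ¬ Step d i) → ∃ λ e → RunAt d s e
  runAt-from {d} {s} st stops-left = extend (length A) (suc s) (m≤n+m _ _) ≤-refl (Steps-extend Steps-empty st)
    where
    extend : ∀ fuel e → length A ≤ e + fuel → s < e → Steps d s (suc e) → ∃ λ e' → RunAt d s e'
    extend fuel e _ s<e steps with LeadingStep-dec sto d (drop e A)
    extend fuel       e _     s<e steps | no ¬st = e , record { s<e = s<e ; steps = steps ; stops-left = stops-left ; stops-right = λ { (at st) → ¬st st } }
    extend zero       e bound _   _     | yes st = contradiction (≤-trans bound (≤-reflexive (+-identityʳ e))) (<⇒≱ (<-trans (n<1+n e) (Step⇒< e (at st))))
    extend (suc fuel) e bound s<e steps | yes st =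
      extend fuel (suc e) (≤-trans bound (≤-reflexive (+-suc e fuel))) (m<n⇒m<1+n s<e) (Steps-extend steps (at st))

  next-run : ∀ {d s e} → RunAt d s e → suc e < length A → ∃ λ e' → RunAt (not d) e e'
  next-run {d} {s} {e} r e+1<∣A∣ = runAt-from (Step-total d e+1<∣A∣ (RunAt.stops-right r)) turns
    where
    turns : ∀ {i} → suc i ≡ e → ¬ Step (not d) i
    turns refl = Step-opposite (RunAt.steps r (≤-pred (RunAt.s<e r)) ≤-refl)

  same-direction-runs-apart : ∀ {d s e s' e'} → RunAt d s e → RunAt d s' e' → s < s' → e < s'
  same-direction-runs-apart r r' s<s' with m≤n⇒m<n∨m≡n (runs-ordered r r' s<s')
  ... | inj₁ e<s' = e<s'
  ... | inj₂ refl = ⊥-elim (runs-alternate r r')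

  opposite-run-between : ∀ {d s e s' e'} → RunAt d s e → RunAt d s' e' → s < s' →
                         ∃ λ e'' → RunAt (not d) e e'' × e'' ≤ s'
  opposite-run-between r r' s<s' with next-run r (≤-<-trans e<s' (<-trans (n<1+n _) (Step⇒< _ (RunAt.steps r' ≤-refl (s≤s (RunAt.s<e r'))))))
    where e<s' = same-direction-runs-apart r r' s<s'
  ... | e'' , r'' = e'' , r'' , runs-ordered r'' r' (same-direction-runs-apart r r' s<s')

  -- Runs alternate in direction: if neither the second nor the third run goes in direction b,
  -- the run starting at the end of the second one does.
  run-in-direction-between : ∀ b {d₁ d₂ d₃ d₄ s₁ s₂ s₃ s₄ e₁ e₂ e₃ e₄} →
                             RunAt d₁ s₁ e₁ → RunAt d₂ s₂ e₂ → RunAt d₃ s₃ e₃ → RunAt d₄ s₄ e₄ →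
                             s₁ < s₂ → s₂ < s₃ → s₃ < s₄ → ∃₂ λ s e → RunAt b s e × e₁ ≤ s × e ≤ s₄
  run-in-direction-between b {d₂ = d₂} {d₃} r₁ r₂ r₃ r₄ s₁<s₂ s₂<s₃ s₃<s₄ with d₂ ≟ᵇ b | d₃ ≟ᵇ b
  ... | yes refl | _        = _ , _ , r₂ , runs-ordered r₁ r₂ s₁<s₂ , <⇒≤ (≤-<-trans (runs-ordered r₂ r₃ s₂<s₃) s₃<s₄)
  ... | no _     | yes refl = _ , _ , r₃ , ≤-trans (runs-ordered r₁ r₂ s₁<s₂) (<⇒≤ s₂<s₃) , runs-ordered r₃ r₄ s₃<s₄
  ... | no d₂≢b  | no d₃≢b  with opposite-run-between r₂ (subst (λ d → RunAt d _ _) (trans (¬-not d₃≢b) (sym (¬-not d₂≢b))) r₃) s₂<s₃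
  ... | e , r , e≤s₃ = _ , _ , subst (λ d → RunAt d _ e) (sym (¬-not (λ b≡d₂ → d₂≢b (sym b≡d₂)))) r ,
                       ≤-trans (runs-ordered r₁ r₂ s₁<s₂) (<⇒≤ (RunAt.s<e r₂)) , <⇒≤ (≤-<-trans e≤s₃ s₃<s₄)

  Linked⇒Steps : ∀ {d s W q} → drop s A ≡ W ++ q → Linked (Ordered _<ₛ_ d) W → Steps d s (s + length W)
  Linked⇒Steps {s = s} {W = []}    _  _ s≤i i+1< = contradiction (≤-trans i+1< (≤-reflexive (+-identityʳ s))) (<⇒≱ (s≤s (m≤n⇒m≤1+n s≤i)))
  Linked⇒Steps {s = s} {W = _ ∷ []} _ _ s≤i i+1< = contradiction (≤-trans i+1< (≤-reflexive (+-comm s 1))) (<⇒≱ (s≤s (s≤s s≤i)))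
  Linked⇒Steps {s = s} {W = x ∷ y ∷ W} eq (o ∷ lin) s≤i i+1< with m≤n⇒m<n∨m≡n s≤i
  ... | inj₂ refl = at (subst (LeadingStep _<ₛ_ _) (sym eq) (step o))
  ... | inj₁ s<i  = Linked⇒Steps (drop-suc s A eq) lin s<i (≤-trans i+1< (≤-reflexive (+-suc s _)))

  Steps⇒Linked : ∀ {d s W q} → drop s A ≡ W ++ q → Steps d s (s + length W) → Linked (Ordered _<ₛ_ d) W
  Steps⇒Linked {W = []}         _  _     = []
  Steps⇒Linked {W = _ ∷ []}     _  _     = [-]
  Steps⇒Linked {s = s} {W = x ∷ y ∷ W} eq steps =
    Step-ordered (steps ≤-refl (subst (_< s + suc (suc (length W))) (+-comm s 1) (+-monoʳ-< s (s≤s (s≤s z≤n))))) eq ∷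
    Steps⇒Linked (drop-suc s A eq) (λ s<i i+1< → steps (<⇒≤ s<i) (≤-trans i+1< (≤-reflexive (sym (+-suc s _)))))

  run-stops-left : ∀ {d} (r : Run _<ₛ_ A) → Linked (Ordered _<ₛ_ d) (Run.seg r) →
                   ∀ {i} → suc i ≡ length (Run.pre r) → ¬ Step d i
  run-stops-left {d} record { pre = pre ; seg = seg ; post = post ; split = split ; maximal = maximal } lin i+1≡ st
    with initLast pre
  ... | []      = 1+n≢0 i+1≡
  ... | p ∷ʳ′ a =
    maximal p (a ∷ []) [] post refl refl (λ ()) (Linked⇒Monotone _<ₛ_ d (subst (λ xs → Linked _ (a ∷ xs)) (sym (++-identityʳ seg)) (Step-cons-Linked st' drop-p lin)))
    where
    drop-p : drop (length p) A ≡ a ∷ seg ++ post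
    drop-p = drop-prefix p (trans split (∷ʳ-++ p a (seg ++ post)))
    st' = subst (Step _) (suc-injective (trans i+1≡ (length-∷ʳ p))) st

  run-stops-right : ∀ {d} (r : Run _<ₛ_ A) → Linked (Ordered _<ₛ_ d) (Run.seg r) → 1 ≤ length (Run.seg r) →
                    ∀ {e} → length (Run.pre r) + length (Run.seg r) ≡ suc e → ¬ Step d e
  run-stops-right {d} record { pre = pre ; seg = seg ; post = post ; split = split ; maximal = maximal } lin 1≤∣seg∣ {e} ∣seg∣≡ st
    with initLast seg
  ... | []      = contradiction 1≤∣seg∣ λ ()
  ... | W ∷ʳ′ z with Step-next st drop-e
    where
    open ≡-Reasoning
    e≡ : length pre + length W ≡ e
    e≡ = suc-injective (trans (sym (+-suc _ _)) (trans (cong (length pre +_) (sym (length-∷ʳ W))) ∣seg∣≡))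
    drop-e : drop e A ≡ z ∷ post
    drop-e = begin
      drop e A                              ≡⟨ cong (λ n → drop n A) (sym e≡) ⟩
      drop (length pre + length W) A        ≡⟨ sym (drop-drop (length pre) (length W) A) ⟩
      drop (length W) (drop (length pre) A) ≡⟨ cong (drop (length W)) (drop-prefix pre (trans split (cong (pre ++_) (∷ʳ-++ W z post)))) ⟩
      drop (length W) (W ++ z ∷ post)       ≡⟨ drop-length-++ W ⟩
      z ∷ post                              ∎
  ... | b , q , refl , o =
    maximal pre [] (b ∷ []) q (++-identityʳ pre) refl (λ ())
      (Linked⇒Monotone _<ₛ_ d (subst (Linked _) (sym (++-assoc W (z ∷ []) (b ∷ []))) (Linked-snoc W lin o)))

  run⇒runAt : (r : Run _<ₛ_ A) → 2 ≤ length (Run.seg r) →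
              ∃₂ λ d e → RunAt d (length (Run.pre r)) e × length (Run.pre r) + length (Run.seg r) ≡ suc e
  run⇒runAt r 2≤∣seg∣ with Monotone⇒Linked _<ₛ_ (Run.mono r) | m≤n⇒∃[o]m+o≡n (≤-trans (s≤s z≤n) (≤-trans 2≤∣seg∣ (m≤n+m _ (length (Run.pre r)))))
  ... | d , lin | e , 1+e≡ = d , e , run , sym 1+e≡
    where
    p = length (Run.pre r)
    run : RunAt d p e
    run = record
      { s<e         = ≤-pred (subst (suc (suc p) ≤_) (sym 1+e≡) (subst (_≤ p + length (Run.seg r)) (+-comm p 2) (+-monoʳ-≤ p 2≤∣seg∣)))
      ; steps       = subst (Steps d p) (sym 1+e≡) (Linked⇒Steps (drop-prefix (Run.pre r) (Run.split r)) lin)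
      ; stops-left  = run-stops-left r lin
      ; stops-right = run-stops-right r lin (≤-trans (s≤s z≤n) 2≤∣seg∣) (sym 1+e≡)
      }

  runAt-not-extendable : ∀ {d s e} → RunAt d s e → ∀ L (a b : List C) → L + length a ≡ s → a ++ b ≢ [] →
                         ¬ (∀ {i} → L ≤ i → suc i < suc e + length b → Step d i)
  runAt-not-extendable r L []      []      _      a++b≢[] _      = a++b≢[] refl
  runAt-not-extendable {e = e} r L (_ ∷ a) b L+∣a∣≡ _ within =
    RunAt.stops-left r i+1≡s (within (m≤m+n L _) (subst (_< suc e + length b) (sym i+1≡s) (≤-trans (m<n⇒m<1+n (RunAt.s<e r)) (m≤m+n _ _))))
    where i+1≡s = trans (sym (+-suc L (length a))) L+∣a∣≡
  runAt-not-extendable {e = e} r L []      (_ ∷ b) L+0≡s _ within =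
    RunAt.stops-right r (within (≤-trans (subst (L ≤_) L+0≡s (m≤m+n L 0)) (<⇒≤ (RunAt.s<e r))) (m<m+n (suc e) (s≤s z≤n)))

  RunAt-end< : ∀ {d s e} → RunAt d s e → e < length A
  RunAt-end< {e = zero}  r = contradiction (RunAt.s<e r) λ ()
  RunAt-end< {e = suc e} r = Step⇒< e (RunAt.steps r (≤-pred (RunAt.s<e r)) ≤-refl)

  runAt-window : ∀ {d s e} → RunAt d s e →
                 ∃₂ λ u W → ∃ λ v → A ≡ u ++ W ++ v × length u ≡ s × s + length W ≡ suc e × Linked (Ordered _<ₛ_ d) W
  runAt-window {d} {s} {e} r with m≤n⇒∃[o]m+o≡n (<⇒≤ (RunAt.s<e r))
  ... | o , s+o≡e with split-at s (suc o) A (subst (_≤ length A) (sym s+1+o≡) (RunAt-end< r))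
    where s+1+o≡ = trans (+-suc s o) (cong suc s+o≡e)
  ... | u , W , v , split , ∣u∣≡s , ∣W∣≡ = u , W , v , split , ∣u∣≡s , s+∣W∣≡ ,
        Steps⇒Linked (trans (cong (λ n → drop n A) (sym ∣u∣≡s)) (drop-prefix u split)) (subst (Steps d s) (sym s+∣W∣≡) (RunAt.steps r))
    where s+∣W∣≡ = trans (cong (s +_) ∣W∣≡) (trans (+-suc s o) (cong suc s+o≡e))

  runAt-maximal : ∀ {d s e} → RunAt d s e → ∀ {u W v} → A ≡ u ++ W ++ v → length u ≡ s → s + length W ≡ suc e →
                  ∀ p a b q → p ++ a ≡ u → b ++ q ≡ v → a ++ b ≢ [] → ¬ Monotone _<ₛ_ (a ++ W ++ b)
  runAt-maximal {d} {s} {e} r {u} {W} {v} split ∣u∣≡s s+∣W∣≡ p a b q p++a≡u b++q≡v a++b≢[] mono with Monotone⇒Linked _<ₛ_ mono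
  ... | d' , lin' = runAt-not-extendable r (length p) a b ∣p∣+∣a∣≡s a++b≢[] within
    where
    open ≡-Reasoning
    ∣p∣+∣a∣≡s : length p + length a ≡ s
    ∣p∣+∣a∣≡s = trans (sym (length-++ p)) (trans (cong length p++a≡u) ∣u∣≡s)
    A≡ : A ≡ p ++ (a ++ W ++ b) ++ q
    A≡ = begin
      A                          ≡⟨ split ⟩
      u ++ W ++ v                ≡⟨ cong₂ (λ x y → x ++ W ++ y) (sym p++a≡u) (sym b++q≡v) ⟩
      (p ++ a) ++ W ++ b ++ q    ≡⟨ ++-assoc p a (W ++ b ++ q) ⟩
      p ++ a ++ W ++ b ++ q      ≡⟨ cong (λ x → p ++ a ++ x) (sym (++-assoc W b q)) ⟩
      p ++ a ++ (W ++ b) ++ q    ≡⟨ cong (p ++_) (sym (++-assoc a (W ++ b) q)) ⟩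
      p ++ (a ++ W ++ b) ++ q    ∎
    ∣window∣ : length p + length (a ++ W ++ b) ≡ suc e + length b
    ∣window∣ = begin
      length p + length (a ++ W ++ b)               ≡⟨ cong (length p +_) (trans (length-++ a) (cong (length a +_) (length-++ W))) ⟩
      length p + (length a + (length W + length b)) ≡⟨ sym (+-assoc (length p) (length a) _) ⟩
      (length p + length a) + (length W + length b) ≡⟨ cong (_+ (length W + length b)) ∣p∣+∣a∣≡s ⟩
      s + (length W + length b)                     ≡⟨ sym (+-assoc s (length W) (length b)) ⟩
      s + length W + length b                       ≡⟨ cong (_+ length b) s+∣W∣≡ ⟩
      suc e + length b                              ∎
    steps' : ∀ {i} → length p ≤ i → suc i < suc e + length b → Step d' i
    steps' {i} p≤i i+1< = Linked⇒Steps (drop-prefix p A≡) lin' p≤i (subst (suc i <_) (sym ∣window∣) i+1<)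
    -- The extended window contains the first step of the run, so it has the run's direction.
    d'≡d : d' ≡ d
    d'≡d = Step-direction (steps' (subst (length p ≤_) ∣p∣+∣a∣≡s (m≤m+n _ _)) (≤-trans (s≤s (RunAt.s<e r)) (m≤m+n _ _)))
                          (RunAt.steps r ≤-refl (s≤s (RunAt.s<e r)))
    within : ∀ {i} → length p ≤ i → suc i < suc e + length b → Step d i
    within {i} p≤i i+1< = subst (λ d'' → Step d'' i) d'≡d (steps' p≤i i+1<)

  runAt⇒run : ∀ {d s e} → RunAt d s e → Σ (Run _<ₛ_ A) λ r → s + length (Run.seg r) ≡ suc e
  runAt⇒run {d} r with runAt-window r
  ... | u , W , v , split , ∣u∣≡s , s+∣W∣≡ , lin =
    record { pre = u ; seg = W ; post = v ; split = split ; mono = Linked⇒Monotone _<ₛ_ d lin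
           ; maximal = runAt-maximal r split ∣u∣≡s s+∣W∣≡ } , s+∣W∣≡

  long-runAt : ∀ {k} → Rollercoaster _<ₛ_ k A → ∀ {d s e} → RunAt d s e → k + s ≤ suc e
  long-runAt {k} rc {s = s} r with runAt⇒run r
  ... | r' , s+∣seg∣≡ = subst (k + s ≤_) (trans (+-comm _ s) s+∣seg∣≡) (+-monoˡ-≤ s (rc r'))

  run-position : ∀ {x} (r : Run _<ₛ_ A) → x ∈ Run.seg r →
                 ∃₂ λ i ys → drop i A ≡ x ∷ ys × length (Run.pre r) ≤ i × i < length (Run.pre r) + length (Run.seg r)
  run-position r x∈seg with ∈⇒drop-++ (Run.post r) x∈seg
  ... | j , ys , j< , eq = length (Run.pre r) + j , ys , drop-eq , m≤m+n _ _ , +-monoʳ-< _ j<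
    where drop-eq = trans (sym (drop-drop (length (Run.pre r)) j A)) (trans (cong (drop j) (drop-prefix (Run.pre r) (Run.split r))) eq)

  runAt-chain : ∀ {d s e} → RunAt d s e → ∀ {i j} → i ≤ s → e < j →
                ∃₂ λ t w → i + suc t ≡ j × w ⊆ take (suc t) (drop i A) × Linked (Ordered _<ₛ_ d) w × s + length w ≡ suc e
  runAt-chain {s = s} R {i} {j} i≤s e<j with runAt-window R | m≤n⇒∃[o]m+o≡n (≤-<-trans (≤-trans i≤s (<⇒≤ (RunAt.s<e R))) e<j)
  ... | u , W , v , split , ∣u∣≡s , s+∣W∣≡ , lin | t , i+1+t≡j =
    t , W , i+suc-t≡j , window-⊆ i s (suc t) A drop-s i≤s (subst (_ ≤_) (sym i+suc-t≡j) (subst (_≤ j) (sym s+∣W∣≡) e<j)) , lin , s+∣W∣≡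
    where
    i+suc-t≡j = trans (+-suc i t) i+1+t≡j
    drop-s = trans (cong (λ n → drop n A) (sym ∣u∣≡s)) (drop-prefix u split)

  chain-between-runs : ∀ {k} → Rollercoaster _<ₛ_ k A → 3 ≤ k → ∀ d (r₁ r₂ r₃ r₄ : Run _<ₛ_ A) →
                       length (Run.pre r₁) < length (Run.pre r₂) → length (Run.pre r₂) < length (Run.pre r₃) →
                       length (Run.pre r₃) < length (Run.pre r₄) →
                       ∀ {i j} → i < length (Run.pre r₁) + length (Run.seg r₁) → length (Run.pre r₄) < j →
                       ∃₂ λ t w → i + suc t ≡ j × w ⊆ take (suc t) (drop i A) × Linked (Ordered _<ₛ_ d) w × k ≤ length w
  chain-between-runs {k} rc 3≤k d r₁ r₂ r₃ r₄ p₁₂ p₂₃ p₃₄ {i} i<end₁ s₄<j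
    with run⇒runAt r₁ (long r₁) | run⇒runAt r₂ (long r₂) | run⇒runAt r₃ (long r₃) | run⇒runAt r₄ (long r₄)
    where
    long : ∀ r → 2 ≤ length (Run.seg r)
    long r = ≤-trans (s≤s (s≤s z≤n)) (≤-trans 3≤k (rc r))
  ... | _ , _ , R₁ , end₁ | _ , _ , R₂ , _ | _ , _ , R₃ , _ | _ , _ , R₄ , _
    with run-in-direction-between d R₁ R₂ R₃ R₄ p₁₂ p₂₃ p₃₄
  ... | s , e , R , e₁≤s , e≤s₄
    with runAt-chain R (≤-trans (≤-pred (subst (i <_) end₁ i<end₁)) e₁≤s) (≤-<-trans e≤s₄ s₄<j)
  ... | t , w , i+suc-t≡j , w⊆ , lin , s+∣w∣≡ =
    t , w , i+suc-t≡j , w⊆ , lin , +-cancelʳ-≤ s k (length w) (subst (k + s ≤_) (trans (sym s+∣w∣≡) (+-comm s _)) (long-runAt rc R))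

module _ {C : Set} {_<ₛ_ : C → C → Set} (sto : IsStrictTotalOrder _≡_ _<ₛ_) {A : List C} (uA : Unique A) where
  open Positions sto A uA

  minimal-block-meets-at-most-four-runs : ∀ {k} → 3 ≤ k → Rollercoaster _<ₛ_ k A →
                                          ∀ X P {Y} → A ⊆ X ++ P ++ Y → Unique (X ++ P ++ Y) →
                                          ∀ {d} → PrefixMinimal {_<ₛ_ = _<ₛ_} k d P → AtMostFourRuns _<ₛ_ A P
  minimal-block-meets-at-most-four-runs 3≤k rc X P A⊆ u {d} minimal
    (r₁ , r₂ , r₃ , r₄ , r₅ , p₁₂ , p₂₃ , p₃₄ , p₄₅ , (x , x∈r₁ , x∈P) , _ , _ , _ , (y , y∈r₅ , y∈P)) =
    let i , _ , at-x , _ , i<end₁ = run-position r₁ x∈r₁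
        j , ys , at-y , s₅≤j , _  = run-position r₅ y∈r₅
        t , w , i+1+t≡j , w⊆ , lin , k≤∣w∣ =
          chain-between-runs rc 3≤k d r₁ r₂ r₃ r₄ p₁₂ p₂₃ p₃₄ i<end₁ (<-≤-trans p₄₅ s₅≤j)
        Q , Q' , P≡ , Q'≢[] , ⊆Q =
          interval-⊆-proper-prefix X P i t A⊆ u at-x (subst (λ n → drop n A ≡ y ∷ ys) (sym i+1+t≡j) at-y) x∈P y∈P
    in <⇒≱ (proper-prefix-ChainsBelow {d = d} (≤-trans (s≤s z≤n) 3≤k) minimal P≡ Q'≢[] w (⊆-trans w⊆ ⊆Q) lin) k≤∣w∣

proposition4 : {C : Set} (_<ₛ_ : C → C → Set) → IsStrictTotalOrder _≡_ _<ₛ_ →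
    (k : ℕ) → 3 ≤ k →
    (S : List C) → Unique S →
    (parts : List (List C)) → AlternatingDecomposition _<ₛ_ k S parts →
    (A : List C) → A ⊆ S → Rollercoaster _<ₛ_ k A →
    (P : List C) → P ∈ parts → AtMostFourRuns _<ₛ_ A P
proposition4 _<ₛ_ sto k 3≤k S uS parts dec A A⊆S rc P P∈parts with part-minimal dec P∈parts
... | d , X , Y , refl , minimal =
  minimal-block-meets-at-most-four-runs sto (Unique-resp-⊇ A⊆S uS) 3≤k rc X P A⊆S uS {d} minimal
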